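{- Let $V$ be a finite set of variables, let $g$ be a term with $\hat g\subseteq V$, and let $Call=(cl_1,sh_1)$ and $Prime=(cl_2,sh_2)$ be elements of $SH^{w}$ such that every set occurring in $cl_1\cup sh_1$ is a subset of $V$, every set occurring in $cl_2\cup sh_2$ is a subset of $\hat g$, and $Prime$ is normalized. Let $extend^s(Call,g,Prime)=(cl',sh')$. Then \[ \downarrow\!\!(cl')\cup sh' \;\supseteq\; extend\big(\downarrow\!\!(cl_1)\cup sh_1,\ g,\ \downarrow\!\!(cl_2)\cup sh_2\big). \]
   Context: For a set $S$, $\wp^0(S)$ denotes the set of nonempty subsets of $S$. Variables of interest form a finite set $V$; for a term (or atom) $t$, $\hat t$ denotes its set of variables. A sharing group is a nonempty subset of $V$; a sharing set is a set of sharing groups; $SH$ is the set of all sharing sets. A clique is a nonempty subset $C\subseteq V$, standing for all groups in $\downarrow C:=\wp^0(C)$; a clique set $cl$ is a set of cliques, and $\downarrow\!\!(cl):=\bigcup_{C\in cl}\wp^0(C)$. The Clique-Sharing domain $SH^{w}$ consists of pairs $(cl,sh)$ of a clique set and a sharing set; the pair represents the sharing set $\downarrow\!\!(cl)\cup sh$. Operations on a set $s$ of sets of variables (sharing set or clique set): $s_1\uplus s_2=\{A\cup B\mid A\in s_1,B\in s_2\}$ (binary union); $s^*$ is the closure of $s$ under (nonempty finite) unions (star union); for a term $t$, $s_t=\{A\in s\mid A\cap\hat t\neq\emptyset\}$ and $\overline{s_t}=s\setminus s_t$; for a variable $x$, $s_x=\{A\in s\mid x\in A\}$. For $S\subseteq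 V$ and a clique set $cl$, $\overline{rel}(S,cl)=\{C\setminus S\mid C\in cl\}\setminus\{\emptyset\}$. A pair $(cl,sh)\in SH^w$ is normalized if whenever $s\subseteq \downarrow\!\!(cl)\cup sh$ with $s=\wp^0(c)$ for some set $c$, then $s\cap sh=\emptyset$. $normalize$ denotes a function mapping a pair $(cl,sh)$ to a normalized pair $(cl'',sh'')$ with $\downarrow\!\!(cl'')\cup sh''=\downarrow\!\!(cl)\cup sh$. Classical extend on sharing sets: $extend(Call,g,Prime)=\overline{Call_g}\cup\{s\mid s\in Call_g^*,\ (s\cap\hat g)\in Prime\}$. Clique extend: given $Call=(cl_1,sh_1)$, $Prime=(cl_2,sh_2)$ (with $Prime$ normalized), let $(cl^\circ,sh^\circ)=normalize\big(({cl_1}_g)^*\cup(({cl_1}_g)^*\uplus({sh_1}_g)^*),\ ({sh_1}_g)^*\big)$ and define $extsh(sh_1,g,sh_2)=\overline{{sh_1}_g}\cup\{s\mid s\in sh^\circ,\ (s\cap\hat g)\in sh_2\}$; $extcl(cl_1,g,cl_2)=\overline{rel}(\hat g,cl_1)\cup\{(s'\cap s)\cup(s'\setminus\hat g)\mid s'\in cl^\circ,\ s\in cl_2\}$; $clsh(cl^\circ,g,sh_2)=\{s\mid s\subseteq c \text{ for some } c\in cl^\circ,\ (s\cap\hat g)\in sh_2\}$; $shcl(sh^\circ,g,cl_2)=\{s\mid s\in sh^\circ,\ (s\cap\hat g)\subseteq c\text{ for some } c\in cl_2\}$. Then $extend^s((cl_1,sh_1),g,(cl_2,sh_2))=\big(extcl(cl_1,g,cl_2),\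 extsh(sh_1,g,sh_2)\cup clsh(cl^\circ,g,sh_2)\cup shcl(sh^\circ,g,cl_2)\big)$. -}

module Defs where

open import Data.Nat using (ℕ)
open import Data.Product using (Σ; ∃; _×_; _,_)
open import Data.Sum using (_⊎_)
open import Relation.Nullary using (¬_)
open import Relation.Binary.PropositionalEquality using (_≡_; _≢_)
open import Data.Fin.Subset using (Subset; Nonempty; _⊆_; _∪_; _∩_; _─_)
  renaming (⊥ to ∅)

-- Variables of interest: V = Fin n.  A set of variables is a Subset n.
-- A set of sets of variables (sharing set / clique set) is a predicate on Subset n.
Fam : ℕ → Set₁
Fam n = Subset n → Set

module _ {n : ℕ} where

  infixr 6 _∪ᶠ_
  _∪ᶠ_ : Fam n → Fam n → Fam n
  (s₁ ∪ᶠ s₂) X = s₁ X ⊎ s₂ X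

  ℘⁰ : Subset n → Fam n
  ℘⁰ c X = Nonempty X × X ⊆ c

  ↓ : Fam n → Fam n
  ↓ cl X = ∃ λ C → cl C × ℘⁰ C X

  ⟦_,_⟧ : Fam n → Fam n → Fam n
  ⟦ cl , sh ⟧ = ↓ cl ∪ᶠ sh

  _⊎ᶠ_ : Fam n → Fam n → Fam n
  (s₁ ⊎ᶠ s₂) X = ∃ λ A → ∃ λ B → s₁ A × s₂ B × X ≡ A ∪ B

  data Star (s : Fam n) : Fam n where
    base  : ∀ {A} → s A → Star s A
    union : ∀ {A B} → Star s A → Star s B → Star s (A ∪ B)

  -- s_t = { A ∈ s | A ∩ t̂ ≠ ∅ }   (t given by its variable set t̂)
  rel : Fam n → Subset n → Fam n
  rel s t X = s X × X ∩ t ≢ ∅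

  irrel : Fam n → Subset n → Fam n
  irrel s t X = s X × X ∩ t ≡ ∅

  relbar : Subset n → Fam n → Fam n
  relbar S cl X = (∃ λ C → cl C × X ≡ C ─ S) × X ≢ ∅

  Within : Subset n → Fam n → Set
  Within S s = ∀ X → s X → X ⊆ S

  AllNonempty : Fam n → Set
  AllNonempty s = ∀ X → s X → Nonempty X

  Normalized : Fam n → Fam n → Set
  Normalized cl sh =
    ∀ c → (∀ X → ℘⁰ c X → ⟦ cl , sh ⟧ X) → ∀ X → ℘⁰ c X → ¬ sh X

  IsNormalizationOf : Fam n → Fam n → Fam n → Fam n → Set
  IsNormalizationOf cl″ sh″ cl sh =
    Normalized cl″ sh″ × (∀ X → (⟦ cl″ , sh″ ⟧ X → ⟦ cl , sh ⟧ X) × (⟦ cl , sh ⟧ X → ⟦ cl″ , sh″ ⟧ X))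

  extend : Fam n → Subset n → Fam n → Fam n
  extend Call g Prime X =
    irrel Call g X ⊎ (Star (rel Call g) X × Prime (X ∩ g))

  -- arguments of normalize in the clique extend
  clPre : Fam n → Fam n → Subset n → Fam n
  clPre cl₁ sh₁ g = Star (rel cl₁ g) ∪ᶠ (Star (rel cl₁ g) ⊎ᶠ Star (rel sh₁ g))

  shPre : Fam n → Subset n → Fam n
  shPre sh₁ g = Star (rel sh₁ g)

  -- components of extendˢ, parameterised by the chosen normalization (cl°, sh°)
  extsh : (sh° : Fam n) → Fam n → Subset n → Fam n → Fam n
  extsh sh° sh₁ g sh₂ X = irrel sh₁ g X ⊎ (sh° X × sh₂ (X ∩ g))

  extcl : (cl° : Fam n) → Fam n → Subset n → Fam n → Fam n
  extcl cl° cl₁ g cl₂ X =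
    relbar g cl₁ X ⊎
    (∃ λ s′ → ∃ λ s → cl° s′ × cl₂ s × X ≡ (s′ ∩ s) ∪ (s′ ─ g))

  clsh : (cl° : Fam n) → Subset n → Fam n → Fam n
  clsh cl° g sh₂ X = (∃ λ c → cl° c × X ⊆ c) × sh₂ (X ∩ g)

  shcl : (sh° : Fam n) → Subset n → Fam n → Fam n
  shcl sh° g cl₂ X = sh° X × (∃ λ c → cl₂ c × X ∩ g ⊆ c)

  extendˢ-cl : (cl° sh° : Fam n) → Fam n → Fam n → Subset n → Fam n → Fam n → Fam n
  extendˢ-cl cl° sh° cl₁ sh₁ g cl₂ sh₂ = extcl cl° cl₁ g cl₂

  extendˢ-sh : (cl° sh° : Fam n) → Fam n → Fam n → Subset n → Fam n → Fam n → Fam n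
  extendˢ-sh cl° sh° cl₁ sh₁ g cl₂ sh₂ =
    extsh sh° sh₁ g sh₂ ∪ᶠ clsh cl° g sh₂ ∪ᶠ shcl sh° g cl₂

-- Groups of extend ↓cl₁ ∪ sh₁ that do not meet g are either sub-groups of a clique C ∈ cl₁,
-- hence of the clique C ─ g of rel-bar(ĝ, cl₁), or groups of sh₁ kept by extsh.  A star union
-- of relevant groups has the form X = (X ∩ C) ∪ B with C a star union of relevant cliques of cl₁
-- and B one of relevant groups of sh₁ (either possibly empty); so X is represented by the
-- argument of normalize, hence by (cl°, sh°).  Combining a clique or group of (cl°, sh°)
-- containing X with a clique or group of (cl₂, sh₂) containing X ∩ ĝ yields one of the four
-- components of extendˢ.
module Submission where

open import Defs
open import Data.Nat using (ℕ)
open import Data.Fin.Base using (Fin)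
open import Data.Fin.Subset using (Subset; Nonempty; _⊆_; _∪_; _∩_; _─_; _∉_)
  renaming (⊥ to ∅)
open import Data.Fin.Subset.Properties
open import Data.Product using (_,_; proj₁; proj₂)
open import Data.Sum using (_⊎_; inj₁; inj₂)
open import Data.Empty using (⊥-elim)
open import Function.Base using (_∘′_)
open import Relation.Nullary using (yes; no)
open import Relation.Binary.PropositionalEquality using (_≡_; refl; subst; sym)
open import Algebra.Bundles using (CommutativeMonoid)
import Algebra.Properties.CommutativeSemigroup as CommutativeSemigroupProperties

module _ {n : ℕ} where

  open CommutativeSemigroupProperties
    (CommutativeMonoid.commutativeSemigroup (∪-commutativeMonoid n)) using (interchange)

  ∪-mono-⊆ : {p q r s : Subset n} → p ⊆ r → q ⊆ s → p ∪ q ⊆ r ∪ s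
  ∪-mono-⊆ {p} {q} p⊆r q⊆s x∈p∪q with x∈p∪q⁻ p q x∈p∪q
  ... | inj₁ x∈p = x∈p∪q⁺ (inj₁ (p⊆r x∈p))
  ... | inj₂ x∈q = x∈p∪q⁺ (inj₂ (q⊆s x∈q))

  ∩-monoˡ-⊆ : {p q : Subset n} (r : Subset n) → p ⊆ q → p ∩ r ⊆ q ∩ r
  ∩-monoˡ-⊆ {p} r p⊆q x∈p∩r with x∈p∩q⁻ p r x∈p∩r
  ... | x∈p , x∈r = x∈p∩q⁺ (p⊆q x∈p , x∈r)

  ⊆-≡∅ : {p q : Subset n} → p ⊆ q → q ≡ ∅ → p ≡ ∅
  ⊆-≡∅ {p} p⊆q refl = ⊆-antisym p⊆q (⊆-min p)

  ∉-≡∅ : {x : Fin n} {p : Subset n} → p ≡ ∅ → x ∉ p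
  ∉-≡∅ refl = ∉⊥

  Nonempty-∩ˡ : {p q : Subset n} → Nonempty (p ∩ q) → Nonempty p
  Nonempty-∩ˡ {p} {q} (x , x∈p∩q) = x , proj₁ (x∈p∩q⁻ p q x∈p∩q)

  ⊆─-disjoint : {p q r : Subset n} → p ⊆ q → p ∩ r ≡ ∅ → p ⊆ q ─ r
  ⊆─-disjoint p⊆q p∩r≡∅ x∈p =
    x∈p∧x∉q⇒x∈p─q (p⊆q x∈p) (λ x∈r → ∉-≡∅ p∩r≡∅ (x∈p∩q⁺ (x∈p , x∈r)))

  ⊆-∩∪─ : {p q r g : Subset n} → p ⊆ q → p ∩ g ⊆ r → p ⊆ (q ∩ r) ∪ (q ─ g)
  ⊆-∩∪─ {g = g} p⊆q p∩g⊆r {x} x∈p with x ∈? g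
  ... | yes x∈g = x∈p∪q⁺ (inj₁ (x∈p∩q⁺ (p⊆q x∈p , p∩g⊆r (x∈p∩q⁺ (x∈p , x∈g)))))
  ... | no  x∉g = x∈p∪q⁺ (inj₂ (x∈p∧x∉q⇒x∈p─q (p⊆q x∈p) x∉g))

  ⟦⟧-nonempty : {cl sh : Fam n} → AllNonempty sh → ∀ {X} → ⟦ cl , sh ⟧ X → Nonempty X
  ⟦⟧-nonempty _     (inj₁ (_ , _ , X≠∅ , _)) = X≠∅
  ⟦⟧-nonempty sh≠∅ (inj₂ X∈sh)              = sh≠∅ _ X∈sh

  -- Admitting ∅ as a unit of _∪_ lets a missing clique part or group part be combined uniformly.
  Star⁰ : Fam n → Fam n
  Star⁰ s X = X ≡ ∅ ⊎ Star s X

  Star⁰-∪ : {s : Fam n} {A B : Subset n} → Star⁰ s A → Star⁰ s B → Star⁰ s (A ∪ B)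
  Star⁰-∪ {s} (inj₁ refl) B∈ = subst (Star⁰ s) (sym (∪-identityˡ _)) B∈
  Star⁰-∪ {s} (inj₂ A∈) (inj₁ refl) = inj₂ (subst (Star s) (sym (∪-identityʳ _)) A∈)
  Star⁰-∪ (inj₂ A∈) (inj₂ B∈) = inj₂ (union A∈ B∈)

  -- group ⊆ X ⊆ clique ∪ group says X = (X ∩ clique) ∪ group.
  record Split (c s : Fam n) (X : Subset n) : Set where
    constructor split
    field
      {clique group} : Subset n
      clique∈ : Star⁰ c clique
      group∈  : Star⁰ s group
      group⊆  : group ⊆ X
      ⊆cover  : X ⊆ clique ∪ group

  Split-∪ : {c s : Fam n} {X Y : Subset n} → Split c s X → Split c s Y → Split c s (X ∪ Y)
  Split-∪ (split {C} {B} C∈ B∈ B⊆X X⊆) (split {D} {B′} D∈ B′∈ B′⊆Y Y⊆) =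
    split (Star⁰-∪ C∈ D∈) (Star⁰-∪ B∈ B′∈) (∪-mono-⊆ B⊆X B′⊆Y)
      (subst (_ ⊆_) (interchange C B D B′) (∪-mono-⊆ X⊆ Y⊆))

  Star-rel-⟦⟧-split : {cl sh : Fam n} {g X : Subset n} →
    Star (rel ⟦ cl , sh ⟧ g) X → Split (rel cl g) (rel sh g) X
  Star-rel-⟦⟧-split {g = g} {X} (base (inj₁ (C , C∈cl , _ , X⊆C) , X∩g≢∅)) =
    split (inj₂ (base (C∈cl , λ C∩g≡∅ → X∩g≢∅ (⊆-≡∅ (∩-monoˡ-⊆ g X⊆C) C∩g≡∅))))
      (inj₁ refl) (⊆-min X) (p⊆p∪q ∅ ∘′ X⊆C)
  Star-rel-⟦⟧-split (base (inj₂ X∈sh , X∩g≢∅)) =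
    split (inj₁ refl) (inj₂ (base (X∈sh , X∩g≢∅))) ⊆-refl (q⊆p∪q ∅ _)
  Star-rel-⟦⟧-split (union A∈ B∈) = Split-∪ (Star-rel-⟦⟧-split A∈) (Star-rel-⟦⟧-split B∈)

  Split-⟦⟧ : {c s : Fam n} {X : Subset n} → Nonempty X → Split c s X →
    ⟦ Star c ∪ᶠ (Star c ⊎ᶠ Star s) , Star s ⟧ X
  Split-⟦⟧ (x , x∈X) (split (inj₁ refl) (inj₁ refl) _ X⊆) =
    ⊥-elim (∉-≡∅ (∪-identityˡ ∅) (X⊆ x∈X))
  Split-⟦⟧ {s = s} _ (split (inj₁ refl) (inj₂ B∈) B⊆X X⊆) =
    inj₂ (subst (Star s) (⊆-antisym B⊆X (subst (_ ⊆_) (∪-identityˡ _) X⊆)) B∈)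
  Split-⟦⟧ X≠∅ (split (inj₂ C∈) (inj₁ refl) _ X⊆) =
    inj₁ (_ , inj₁ C∈ , X≠∅ , subst (_ ⊆_) (∪-identityʳ _) X⊆)
  Split-⟦⟧ X≠∅ (split (inj₂ C∈) (inj₂ B∈) _ X⊆) =
    inj₁ (_ , inj₂ (_ , _ , C∈ , B∈ , refl) , X≠∅ , X⊆)

  module Extendˢ (g : Subset n) (cl₁ sh₁ cl₂ sh₂ cl° sh° : Fam n) where

    ⟦extendˢ⟧ : Fam n
    ⟦extendˢ⟧ = ⟦ extcl cl° cl₁ g cl₂ , extsh sh° sh₁ g sh₂ ∪ᶠ clsh cl° g sh₂ ∪ᶠ shcl sh° g cl₂ ⟧

    irrel-⟦extendˢ⟧ : ∀ {X} → irrel ⟦ cl₁ , sh₁ ⟧ g X → ⟦extendˢ⟧ X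
    irrel-⟦extendˢ⟧ {X} (inj₁ (C , C∈cl₁ , X≠∅@(_ , x∈X) , X⊆C) , X∩g≡∅) =
      inj₁ (_ , inj₁ ((C , C∈cl₁ , refl) , λ C─g≡∅ → ∉-≡∅ C─g≡∅ (X⊆C─g x∈X)) , X≠∅ , X⊆C─g)
      where
        X⊆C─g : X ⊆ C ─ g
        X⊆C─g = ⊆─-disjoint X⊆C X∩g≡∅
    irrel-⟦extendˢ⟧ (inj₂ X∈sh₁ , X∩g≡∅) = inj₂ (inj₁ (inj₁ (X∈sh₁ , X∩g≡∅)))

    ⟦⟧-⟦extendˢ⟧ : ∀ {X} → Nonempty X → ⟦ cl° , sh° ⟧ X → ⟦ cl₂ , sh₂ ⟧ (X ∩ g) → ⟦extendˢ⟧ X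
    ⟦⟧-⟦extendˢ⟧ X≠∅ (inj₁ (C , C∈ , _ , X⊆C)) (inj₁ (D , D∈ , _ , X∩g⊆D)) =
      inj₁ (_ , inj₂ (C , D , C∈ , D∈ , refl) , X≠∅ , ⊆-∩∪─ X⊆C X∩g⊆D)
    ⟦⟧-⟦extendˢ⟧ _ (inj₁ (C , C∈ , _ , X⊆C)) (inj₂ X∩g∈sh₂) =
      inj₂ (inj₂ (inj₁ ((C , C∈ , X⊆C) , X∩g∈sh₂)))
    ⟦⟧-⟦extendˢ⟧ _ (inj₂ X∈sh°) (inj₁ (D , D∈ , _ , X∩g⊆D)) =
      inj₂ (inj₂ (inj₂ (X∈sh° , D , D∈ , X∩g⊆D)))
    ⟦⟧-⟦extendˢ⟧ _ (inj₂ X∈sh°) (inj₂ X∩g∈sh₂) = inj₂ (inj₁ (inj₂ (X∈sh° , X∩g∈sh₂)))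

theorem1 : (n : ℕ) (g : Subset n) (cl₁ sh₁ cl₂ sh₂ : Fam n) →
    AllNonempty cl₁ → AllNonempty sh₁ → AllNonempty cl₂ → AllNonempty sh₂ →
    Within g cl₂ → Within g sh₂ → Normalized cl₂ sh₂ →
    (cl° sh° : Fam n) → IsNormalizationOf cl° sh° (clPre cl₁ sh₁ g) (shPre sh₁ g) →
    ∀ X → extend ⟦ cl₁ , sh₁ ⟧ g ⟦ cl₂ , sh₂ ⟧ X →
    ⟦ extendˢ-cl cl° sh° cl₁ sh₁ g cl₂ sh₂ , extendˢ-sh cl° sh° cl₁ sh₁ g cl₂ sh₂ ⟧ X
theorem1 n g cl₁ sh₁ cl₂ sh₂ _ _ _ _ _ _ _ cl° sh° _ X (inj₁ X-irrelevant) =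
  Extendˢ.irrel-⟦extendˢ⟧ g cl₁ sh₁ cl₂ sh₂ cl° sh° X-irrelevant
theorem1 n g cl₁ sh₁ cl₂ sh₂ _ _ _ sh₂≠∅ _ _ _ cl° sh° (_ , represents-same) X
  (inj₂ (X∈Star , X∩g∈Prime)) =
  Extendˢ.⟦⟧-⟦extendˢ⟧ g cl₁ sh₁ cl₂ sh₂ cl° sh° X≠∅ X∈⟦cl°,sh°⟧ X∩g∈Prime
  where
    X≠∅ : Nonempty X
    X≠∅ = Nonempty-∩ˡ (⟦⟧-nonempty sh₂≠∅ X∩g∈Prime)

    X∈⟦cl°,sh°⟧ : ⟦ cl° , sh° ⟧ X
    X∈⟦cl°,sh°⟧ = proj₂ (represents-same X) (Split-⟦⟧ X≠∅ (Star-rel-⟦⟧-split X∈Star))
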